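{- If $G\parallel\mathcal M$ is balanced ($\vdash G\parallel\mathcal M$), $\omega=\mathrm{otr}(\mathcal M)$ and $\tau\in\mathrm{Tr}(G)$, then $\tau$ is $\omega$-well formed.
   Context: Participants $p,q,r,s$; labels $\ell$. A message is $(p,\ell,q)$; a queue $\mathcal M$ is a finite sequence of messages ($\emptyset$ empty, $\cdot$ concatenation) modulo the equivalence $\equiv$ allowing adjacent $(p,\ell,q),(r,\ell',s)$ to be swapped when $p\neq r$ or $q\neq s$. A communication is $pq!\ell$ or $pq?\ell$. The o-trace of a queue is $\mathrm{otr}(\emptyset)=\epsilon$, $\mathrm{otr}((p,\ell,q)\cdot\mathcal M)=pq!\ell\cdot\mathrm{otr}(\mathcal M)$, considered modulo the analogous equivalence swapping adjacent $pq!\ell$, $rs!\ell'$ when $p\neq r$ or $q\neq s$. Global types: regular terms coinductively generated by $G::=\boxplus_{i\in I}pq!\ell_i;G_i\mid pq?\ell;G\mid\mathsf{End}$ ($I$ finite non-empty, pairwise distinct labels); $\mathrm{Tr}(G)$ is the set of sequences of communications read along paths from the root to an edge of the tree of $G$ (node $pq!$ with an edge $\ell_i$ to $G_i$ gives $pq!\ell_i$; node $pq?$ with edge $\ell$ gives $pq?\ell$); $G$ is cyclic if its tree contains itself as a proper subtree. Balancing: $\vdash G\parallel\mathcal M$ holds if derivable by a possibly infinite derivation from: $\vdash\mathsf{End}\parallel\emptyset$; from $\vdash G\parallel\mathcal M$ infer $\vdash pq?\ell;G\parallel(p,\ell,q)\cdot\mathcal M$; from $\vdash G_i\parallel\mathcal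 M\cdot(p,\ell_i,q)$ for all $i\in I$ infer $\vdash\boxplus_{i\in I}pq!\ell_i;G_i\parallel\mathcal M$, provided $\mathcal M=\emptyset$ if $\boxplus_{i\in I}pq!\ell_i;G_i$ is cyclic. For a trace $\tau$ (finite sequence of communications), $\tau[i]$ is its $i$-th element, $\tau[1..k]$ its prefix of length $k$, and $\#(pq\dagger,\tau)$ counts elements of the form $pq\dagger\ell$ ($\dagger\in\{!,?\}$). In $\tau$, the input $\tau[j]=pq?\ell$ matches the output $\tau[i]=pq!\ell$ if $i<j$ and $\#(pq!,\tau[1..i-1])=\#(pq?,\tau[1..j-1])$. $\tau$ is well formed if every input in it matches an output in it; $\tau$ is $\omega$-well formed if $\omega\cdot\tau$ is well formed. -}

module Defs where

open import Level using (Lift; lift)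

open import Data.Nat using (ℕ; zero; suc; _<_)
open import Data.Nat.Properties using (_≟_)
open import Data.Fin using (Fin; toℕ)
open import Data.List using (List; []; _∷_; _++_; [_]; map; take; length; lookup)
open import Data.List.Membership.Propositional using (_∈_)
open import Data.List.Relation.Unary.Unique.Propositional using (Unique)
open import Data.Bool using (Bool; true; false; _∧_)
open import Data.Product using (_×_; _,_; ∃; Σ; proj₁)
open import Data.Sum using (_⊎_)
open import Data.Unit using (⊤)
open import Relation.Nullary using (¬_; yes; no)
open import Relation.Nullary.Decidable using (⌊_⌋)
open import Relation.Binary.PropositionalEquality using (_≡_; _≢_)
open import Relation.Binary.Construct.Closure.Equivalence using (EqClosure)
open import Relation.Binary.Construct.Closure.Transitive using (TransClosure)

Participant : Set
Participant = ℕ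

Label : Set
Label = ℕ

Message : Set
Message = Participant × Label × Participant

Queue : Set
Queue = List Message

data QSwap : Queue → Queue → Set where
  here  : ∀ {p ℓ q r ℓ′ s} (M : Queue) → (p ≢ r ⊎ q ≢ s) →
          QSwap ((p , ℓ , q) ∷ (r , ℓ′ , s) ∷ M) ((r , ℓ′ , s) ∷ (p , ℓ , q) ∷ M)
  there : ∀ {m M M′} → QSwap M M′ → QSwap (m ∷ M) (m ∷ M′)

_≈Q_ : Queue → Queue → Set
_≈Q_ = EqClosure QSwap

data Comm : Set where
  out : Participant → Participant → Label → Comm
  inp : Participant → Participant → Label → Comm

Trace : Set
Trace = List Comm

otr : Queue → Trace
otr []                  = []
otr ((p , ℓ , q) ∷ M)   = out p q ℓ ∷ otr M

data OSwap : Trace → Trace → Set where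
  here  : ∀ {p q ℓ r s ℓ′} (τ : Trace) → (p ≢ r ⊎ q ≢ s) →
          OSwap (out p q ℓ ∷ out r s ℓ′ ∷ τ) (out r s ℓ′ ∷ out p q ℓ ∷ τ)
  there : ∀ {c τ τ′} → OSwap τ τ′ → OSwap (c ∷ τ) (c ∷ τ′)

_≈O_ : Trace → Trace → Set
_≈O_ = EqClosure OSwap

#out : Participant → Participant → Trace → ℕ
#out p q []                 = 0
#out p q (out p′ q′ _ ∷ τ)  with ⌊ p ≟ p′ ⌋ ∧ ⌊ q ≟ q′ ⌋
... | true  = suc (#out p q τ)
... | false = #out p q τ
#out p q (inp _ _ _ ∷ τ)    = #out p q τ

#inp : Participant → Participant → Trace → ℕ
#inp p q []                 = 0
#inp p q (inp p′ q′ _ ∷ τ)  with ⌊ p ≟ p′ ⌋ ∧ ⌊ q ≟ q′ ⌋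
... | true  = suc (#inp p q τ)
... | false = #inp p q τ
#inp p q (out _ _ _ ∷ τ)    = #inp p q τ

-- Positions are 0-based Fin indices: τ[i+1] of the paper is lookup τ i,
-- and τ[1..i] of the paper (prefix before 0-based position i) is take (toℕ i) τ.
-- The input at j matches the output at i.
Matches : (τ : Trace) → Fin (length τ) → Fin (length τ) → Set
Matches τ j i = ∃ λ p → ∃ λ q → ∃ λ ℓ →
  lookup τ j ≡ inp p q ℓ × lookup τ i ≡ out p q ℓ × toℕ i < toℕ j ×
  #out p q (take (toℕ i) τ) ≡ #inp p q (take (toℕ j) τ)

WellFormed : Trace → Set
WellFormed τ = ∀ (j : Fin (length τ)) p q ℓ → lookup τ j ≡ inp p q ℓ →
  ∃ λ (i : Fin (length τ)) → Matches τ j i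

OmegaWellFormed : Trace → Trace → Set
OmegaWellFormed ω τ = WellFormed (ω ++ τ)

-- Global types, as regular terms: finite graphs whose unfoldings are the trees.

data Node (n : ℕ) : Set where
  Out : Participant → Participant → List (Label × Fin n) → Node n
  In  : Participant → Participant → Label → Fin n → Node n
  End : Node n

record GGraph : Set where
  field
    size : ℕ
    node : Fin size → Node size
open GGraph public

WFNode : ∀ {n} → Node n → Set
WFNode (Out p q bs) = (bs ≢ []) × Unique (map proj₁ bs)
WFNode (In p q ℓ x) = ⊤
WFNode End          = ⊤

WFGraph : GGraph → Set
WFGraph G = ∀ x → WFNode (node G x)

data Edge (G : GGraph) : Fin (size G) → Comm → Fin (size G) → Set where
  eout : ∀ {x p q bs ℓ y} → node G x ≡ Out p q bs → (ℓ , y) ∈ bs → Edge G x (out p q ℓ) y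
  einp : ∀ {x p q ℓ y} → node G x ≡ In p q ℓ y → Edge G x (inp p q ℓ) y

-- equality of the trees (unfoldings) of two nodes: bisimilarity
IsBisim : (G : GGraph) → (Fin (size G) → Fin (size G) → Set) → Set
IsBisim G R = ∀ x y → R x y →
  (∀ c x′ → Edge G x c x′ → ∃ λ y′ → Edge G y c y′ × R x′ y′) ×
  (∀ c y′ → Edge G y c y′ → ∃ λ x′ → Edge G x c x′ × R x′ y′)

SameTree : (G : GGraph) → Fin (size G) → Fin (size G) → Set₁
SameTree G x y = ∃ λ (R : Fin (size G) → Fin (size G) → Set) → IsBisim G R × R x y

-- y is the root of a proper subtree of the tree of x
Reach⁺ : (G : GGraph) → Fin (size G) → Fin (size G) → Set
Reach⁺ G = TransClosure (λ x y → ∃ λ c → Edge G x c y)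

-- the tree of x contains itself as a proper subtree
Cyclic : (G : GGraph) → Fin (size G) → Set₁
Cyclic G x = ∃ λ y → Reach⁺ G x y × SameTree G x y

data Tr (G : GGraph) : Fin (size G) → Trace → Set where
  last : ∀ {x c y} → Edge G x c y → Tr G x [ c ]
  step : ∀ {x c y τ} → Edge G x c y → Tr G y τ → Tr G x (c ∷ τ)

Lift₁ : Set → Set₁
Lift₁ A = Lift _ A

-- Balancing ⊢ G ∥ M (possibly infinite derivations = greatest fixed point).
-- A relation R between nodes and queues is backward closed if each pair in R
-- is the conclusion of a rule whose premises are in R (queues up to ≈Q).

StepN : (G : GGraph) → (Fin (size G) → Queue → Set) →
        Fin (size G) → Node (size G) → Queue → Set₁
StepN G R x (Out p q bs) M =
  (Cyclic G x → M ≡ []) × (∀ ℓ y → (ℓ , y) ∈ bs → R y (M ++ [ (p , ℓ , q) ]))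
StepN G R x (In p q ℓ y) M = Lift₁ (∃ λ M′ → M ≈Q ((p , ℓ , q) ∷ M′) × R y M′)
StepN G R x End M = Lift₁ (M ≈Q [])

BackClosed : (G : GGraph) → (Fin (size G) → Queue → Set) → Set₁
BackClosed G R = ∀ x M → R x M → StepN G R x (node G x) M

Balanced : (G : GGraph) → Fin (size G) → Queue → Set₁
Balanced G x M = ∃ λ (R : Fin (size G) → Queue → Set) → BackClosed G R × R x M

-- Along a path of G starting from a node
-- balanced with queue M and a prefix ω ≈ otr M, the pq-output labels of the
-- prefix read so far are its pq-input labels followed by the pq-labels still
-- queued.  At an input pq?ℓ balancing puts (p,ℓ,q) first among the
-- pq-messages of the queue, so the next pq-output not yet consumed carries ℓ,
-- and its position is the matching output.

module Submission where

open import Defs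
open import Data.Bool using (Bool; true; false; _∧_; if_then_else_)
open import Data.Empty using (⊥-elim)
open import Data.Fin using (Fin; toℕ; zero; suc)
open import Data.List using (List; []; _∷_; _++_; [_]; take; length; lookup; mapMaybe)
open import Data.List.Properties using (++-assoc; ++-identityʳ; mapMaybe-++; ∷-injective)
open import Data.Maybe using (Maybe; just; nothing; maybe′)
open import Data.Nat using (suc; _<_; s≤s; z≤n)
open import Data.Nat.Properties using (_≟_; ≟-diag)
open import Data.Product using (_×_; _,_; ∃; proj₂)
open import Data.Sum using (_⊎_; inj₁; inj₂)
open import Function using (id)
open import Level using (lower)
open import Relation.Nullary using (yes; no)
open import Relation.Nullary.Decidable using (⌊_⌋)
open import Relation.Binary.PropositionalEquality
  using (_≡_; _≢_; refl; sym; trans; cong; cong₂; subst; isEquivalence; module ≡-Reasoning)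
open import Relation.Binary.Construct.Closure.Equivalence using (gmap; gfold)

private
  variable
    A B : Set

mapMaybe-swap : (f : A → Maybe B) {x y : A} (zs : List A) →
  f x ≡ nothing ⊎ f y ≡ nothing → mapMaybe f (x ∷ y ∷ zs) ≡ mapMaybe f (y ∷ x ∷ zs)
mapMaybe-swap f zs (inj₁ fx≡nothing) rewrite fx≡nothing = refl
mapMaybe-swap f zs (inj₂ fy≡nothing) rewrite fy≡nothing = refl

mapMaybe-∷ : (f : A → Maybe B) {x : A} (xs : List A) {m : Maybe B} → f x ≡ m →
  mapMaybe f (x ∷ xs) ≡ maybe′ _∷_ id m (mapMaybe f xs)
mapMaybe-∷ f xs refl = refl

mapMaybe≡[]⇒nothing : (f : A → Maybe B) (xs : List A) → mapMaybe f xs ≡ [] →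
  (i : Fin (length xs)) → f (lookup xs i) ≡ nothing
mapMaybe≡[]⇒nothing f (x ∷ xs) eq i with f x in fx
mapMaybe≡[]⇒nothing f (x ∷ xs) () i       | just _
mapMaybe≡[]⇒nothing f (x ∷ xs) eq zero    | nothing = fx
mapMaybe≡[]⇒nothing f (x ∷ xs) eq (suc i) | nothing = mapMaybe≡[]⇒nothing f xs eq i

mapMaybe-take-source : (f : A → Maybe B) (xs : List A) (j : Fin (length xs))
  (X : List B) (b : B) (Y : List B) → mapMaybe f (take (toℕ j) xs) ≡ X ++ b ∷ Y →
  ∃ λ (i : Fin (length xs)) →
    toℕ i < toℕ j × f (lookup xs i) ≡ just b × mapMaybe f (take (toℕ i) xs) ≡ X
mapMaybe-take-source f (x ∷ xs) zero    []      b Y ()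
mapMaybe-take-source f (x ∷ xs) zero    (_ ∷ _) b Y ()
mapMaybe-take-source f (x ∷ xs) (suc j) X       b Y eq with f x in fx
... | nothing with mapMaybe-take-source f xs j X b Y eq
...   | i , i<j , fi , pre =
  suc i , s≤s i<j , fi , trans (mapMaybe-∷ f (take (toℕ i) xs) fx) pre
mapMaybe-take-source f (x ∷ xs) (suc j) [] b Y refl | just .b = zero , s≤s z≤n , fx , refl
mapMaybe-take-source f (x ∷ xs) (suc j) (x′ ∷ X) b Y eq | just b′ with ∷-injective eq
... | refl , eq′ with mapMaybe-take-source f xs j X b Y eq′
...   | i , i<j , fi , pre =
  suc i , s≤s i<j , fi , trans (mapMaybe-∷ f (take (toℕ i) xs) fx) (cong (b′ ∷_) pre)

lookup-++-split : (xs ys : List A) (j : Fin (length (xs ++ ys))) →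
  (∃ λ (i : Fin (length xs)) → lookup (xs ++ ys) j ≡ lookup xs i) ⊎
  (∃ λ (k : Fin (length ys)) → lookup (xs ++ ys) j ≡ lookup ys k ×
                               take (toℕ j) (xs ++ ys) ≡ xs ++ take (toℕ k) ys)
lookup-++-split []       ys j       = inj₂ (j , refl , refl)
lookup-++-split (x ∷ xs) ys zero    = inj₁ (zero , refl)
lookup-++-split (x ∷ xs) ys (suc j) with lookup-++-split xs ys j
... | inj₁ (i , eq)          = inj₁ (suc i , eq)
... | inj₂ (k , eq , take≡) = inj₂ (k , eq , cong (x ∷_) take≡)

-- The test used by #out and #inp, so that they count the projections below.
onChannel : Participant → Participant → Participant → Participant → Bool
onChannel p q p′ q′ = ⌊ p ≟ p′ ⌋ ∧ ⌊ q ≟ q′ ⌋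

channelLabel : Participant → Participant → Participant → Participant → Label → Maybe Label
channelLabel p q p′ q′ ℓ = if onChannel p q p′ q′ then just ℓ else nothing

outLabel : Participant → Participant → Comm → Maybe Label
outLabel p q (out p′ q′ ℓ) = channelLabel p q p′ q′ ℓ
outLabel p q (inp _ _ _)   = nothing

inLabel : Participant → Participant → Comm → Maybe Label
inLabel p q (inp p′ q′ ℓ) = channelLabel p q p′ q′ ℓ
inLabel p q (out _ _ _)   = nothing

outs : Participant → Participant → Trace → List Label
outs p q = mapMaybe (outLabel p q)

ins : Participant → Participant → Trace → List Label
ins p q = mapMaybe (inLabel p q)

channelLabel-self : ∀ p q ℓ → channelLabel p q p q ℓ ≡ just ℓ
channelLabel-self p q ℓ rewrite ≟-diag (refl {x = p}) | ≟-diag (refl {x = q}) = refl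

channelLabel-just : ∀ p q p′ q′ {ℓ ℓ′} → channelLabel p q p′ q′ ℓ ≡ just ℓ′ →
  p′ ≡ p × q′ ≡ q × ℓ ≡ ℓ′
channelLabel-just p q p′ q′ eq with p ≟ p′ | q ≟ q′ | eq
... | yes refl | yes refl | refl = refl , refl , refl
... | yes _    | no _     | ()
... | no _     | _        | ()

channelLabel-disjoint : ∀ p q {p₁ q₁ ℓ₁ p₂ q₂ ℓ₂} → p₁ ≢ p₂ ⊎ q₁ ≢ q₂ →
  channelLabel p q p₁ q₁ ℓ₁ ≡ nothing ⊎ channelLabel p q p₂ q₂ ℓ₂ ≡ nothing
channelLabel-disjoint p q {p₁} {q₁} {ℓ₁} {p₂} {q₂} {ℓ₂} different
  with channelLabel p q p₁ q₁ ℓ₁ in eq₁ | channelLabel p q p₂ q₂ ℓ₂ in eq₂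
... | nothing | _       = inj₁ refl
... | just _  | nothing = inj₂ refl
... | just _  | just _
  with channelLabel-just p q p₁ q₁ eq₁ | channelLabel-just p q p₂ q₂ eq₂ | different
...   | refl , refl , _ | refl , refl , _ | inj₁ p≢p = ⊥-elim (p≢p refl)
...   | refl , refl , _ | refl , refl , _ | inj₂ q≢q = ⊥-elim (q≢q refl)

outLabel-just : ∀ {p q c ℓ} → outLabel p q c ≡ just ℓ → c ≡ out p q ℓ
outLabel-just {p} {q} {out p′ q′ _} eq with channelLabel-just p q p′ q′ eq
... | refl , refl , refl = refl

#out≡length-outs : ∀ p q τ → #out p q τ ≡ length (outs p q τ)
#out≡length-outs p q []                = refl
#out≡length-outs p q (inp _ _ _ ∷ τ)   = #out≡length-outs p q τ
#out≡length-outs p q (out p′ q′ _ ∷ τ) with onChannel p q p′ q′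
... | true  = cong suc (#out≡length-outs p q τ)
... | false = #out≡length-outs p q τ

#inp≡length-ins : ∀ p q τ → #inp p q τ ≡ length (ins p q τ)
#inp≡length-ins p q []                = refl
#inp≡length-ins p q (out _ _ _ ∷ τ)   = #inp≡length-ins p q τ
#inp≡length-ins p q (inp p′ q′ _ ∷ τ) with onChannel p q p′ q′
... | true  = cong suc (#inp≡length-ins p q τ)
... | false = #inp≡length-ins p q τ

mapMaybe-resp-OSwap : (f : Comm → Maybe B) →
  (∀ {p q ℓ r s ℓ′} → p ≢ r ⊎ q ≢ s → f (out p q ℓ) ≡ nothing ⊎ f (out r s ℓ′) ≡ nothing) →
  ∀ {τ τ′} → OSwap τ τ′ → mapMaybe f τ ≡ mapMaybe f τ′
mapMaybe-resp-OSwap f disjoint (here τ different) = mapMaybe-swap f τ (disjoint different)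
mapMaybe-resp-OSwap f disjoint (there {c} swap) =
  cong (maybe′ _∷_ id (f c)) (mapMaybe-resp-OSwap f disjoint swap)

outs-resp-≈O : ∀ p q {τ τ′} → τ ≈O τ′ → outs p q τ ≡ outs p q τ′
outs-resp-≈O p q =
  gfold isEquivalence (outs p q) (mapMaybe-resp-OSwap (outLabel p q) (channelLabel-disjoint p q))

ins-resp-≈O : ∀ p q {τ τ′} → τ ≈O τ′ → ins p q τ ≡ ins p q τ′
ins-resp-≈O p q = gfold isEquivalence (ins p q) (mapMaybe-resp-OSwap (inLabel p q) (λ _ → inj₁ refl))

QSwap⇒OSwap : ∀ {M M′} → QSwap M M′ → OSwap (otr M) (otr M′)
QSwap⇒OSwap (here M different) = here (otr M) different
QSwap⇒OSwap (there swap)       = there (QSwap⇒OSwap swap)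

outs-otr-resp-≈Q : ∀ p q {M M′} → M ≈Q M′ → outs p q (otr M) ≡ outs p q (otr M′)
outs-otr-resp-≈Q p q M≈M′ = outs-resp-≈O p q (gmap otr QSwap⇒OSwap M≈M′)

otr-++ : ∀ M N → otr (M ++ N) ≡ otr M ++ otr N
otr-++ []      N = refl
otr-++ (m ∷ M) N = cong (_ ∷_) (otr-++ M N)

ins-otr : ∀ p q M → ins p q (otr M) ≡ []
ins-otr p q []      = refl
ins-otr p q (_ ∷ M) = ins-otr p q M

data _─[_]→_ : Queue → Comm → Queue → Set where
  send    : ∀ {M p q ℓ} → M ─[ out p q ℓ ]→ (M ++ [ (p , ℓ , q) ])
  receive : ∀ {M M′ p q ℓ} → M ≈Q ((p , ℓ , q) ∷ M′) → M ─[ inp p q ℓ ]→ M′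

QueueAfter : Trace → Queue → Set
QueueAfter ω M = ∀ p q → outs p q ω ≡ ins p q ω ++ outs p q (otr M)

NextOutput : Participant → Participant → Label → Trace → Set
NextOutput p q ℓ τ = ∃ λ rest → outs p q τ ≡ ins p q τ ++ ℓ ∷ rest

≈O-otr⇒QueueAfter : ∀ {ω M} → ω ≈O otr M → QueueAfter ω M
≈O-otr⇒QueueAfter {ω} {M} ω≈ p q = begin
  outs p q ω                          ≡⟨ outs-resp-≈O p q ω≈ ⟩
  outs p q (otr M)                    ≡⟨ cong (_++ outs p q (otr M)) (ins-otr p q M) ⟨
  ins p q (otr M) ++ outs p q (otr M) ≡⟨ cong (_++ outs p q (otr M)) (ins-resp-≈O p q ω≈) ⟨
  ins p q ω ++ outs p q (otr M)       ∎
  where open ≡-Reasoning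

ins-snoc-out : ∀ p q ω {p′ q′ ℓ} → ins p q (ω ++ [ out p′ q′ ℓ ]) ≡ ins p q ω
ins-snoc-out p q ω = trans (mapMaybe-++ (inLabel p q) ω _) (++-identityʳ _)

outs-snoc-inp : ∀ p q ω {p′ q′ ℓ} → outs p q (ω ++ [ inp p′ q′ ℓ ]) ≡ outs p q ω
outs-snoc-inp p q ω = trans (mapMaybe-++ (outLabel p q) ω _) (++-identityʳ _)

QueueAfter-step : ∀ {M c M′} ω → QueueAfter ω M → M ─[ c ]→ M′ → QueueAfter (ω ++ [ c ]) M′
QueueAfter-step {M} ω after (send {p = p} {q} {ℓ}) p′ q′ = begin
  outs p′ q′ (ω ++ [ c ])
    ≡⟨ mapMaybe-++ (outLabel p′ q′) ω [ c ] ⟩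
  outs p′ q′ ω ++ outs p′ q′ [ c ]
    ≡⟨ cong (_++ outs p′ q′ [ c ]) (after p′ q′) ⟩
  (ins p′ q′ ω ++ outs p′ q′ (otr M)) ++ outs p′ q′ [ c ]
    ≡⟨ ++-assoc (ins p′ q′ ω) _ _ ⟩
  ins p′ q′ ω ++ (outs p′ q′ (otr M) ++ outs p′ q′ [ c ])
    ≡⟨ cong (ins p′ q′ ω ++_) (mapMaybe-++ (outLabel p′ q′) (otr M) [ c ]) ⟨
  ins p′ q′ ω ++ outs p′ q′ (otr M ++ [ c ])
    ≡⟨ cong₂ _++_ (ins-snoc-out p′ q′ ω) (cong (outs p′ q′) (otr-++ M _)) ⟨
  ins p′ q′ (ω ++ [ c ]) ++ outs p′ q′ (otr (M ++ [ (p , ℓ , q) ])) ∎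
  where
  open ≡-Reasoning
  c = out p q ℓ
QueueAfter-step {M} {M′ = M′} ω after (receive {p = p} {q} {ℓ} M≈) p′ q′ = begin
  outs p′ q′ (ω ++ [ c ])
    ≡⟨ outs-snoc-inp p′ q′ ω ⟩
  outs p′ q′ ω
    ≡⟨ after p′ q′ ⟩
  ins p′ q′ ω ++ outs p′ q′ (otr M)
    ≡⟨ cong (ins p′ q′ ω ++_) (outs-otr-resp-≈Q p′ q′ M≈) ⟩
  ins p′ q′ ω ++ outs p′ q′ (out p q ℓ ∷ otr M′)
    ≡⟨ cong (ins p′ q′ ω ++_) (mapMaybe-++ (outLabel p′ q′) [ out p q ℓ ] (otr M′)) ⟩
  ins p′ q′ ω ++ (ins p′ q′ [ c ] ++ outs p′ q′ (otr M′))
    ≡⟨ ++-assoc (ins p′ q′ ω) _ _ ⟨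
  (ins p′ q′ ω ++ ins p′ q′ [ c ]) ++ outs p′ q′ (otr M′)
    ≡⟨ cong (_++ outs p′ q′ (otr M′)) (mapMaybe-++ (inLabel p′ q′) ω [ c ]) ⟨
  ins p′ q′ (ω ++ [ c ]) ++ outs p′ q′ (otr M′) ∎
  where
  open ≡-Reasoning
  c = inp p q ℓ

receive⇒NextOutput : ∀ {M M′ p q ℓ} ω → QueueAfter ω M → M ≈Q ((p , ℓ , q) ∷ M′) →
  NextOutput p q ℓ ω
receive⇒NextOutput {M} {M′} {p} {q} {ℓ} ω after M≈ = outs p q (otr M′) , (begin
  outs p q ω
    ≡⟨ after p q ⟩
  ins p q ω ++ outs p q (otr M)
    ≡⟨ cong (ins p q ω ++_) (outs-otr-resp-≈Q p q M≈) ⟩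
  ins p q ω ++ outs p q (out p q ℓ ∷ otr M′)
    ≡⟨ cong (ins p q ω ++_) (mapMaybe-∷ (outLabel p q) (otr M′) (channelLabel-self p q ℓ)) ⟩
  ins p q ω ++ ℓ ∷ outs p q (otr M′) ∎)
  where open ≡-Reasoning

≈O-otr⇒no-inputs : ∀ {ω M} → ω ≈O otr M →
  (i : Fin (length ω)) → ∀ {p q ℓ} → lookup ω i ≢ inp p q ℓ
≈O-otr⇒no-inputs {ω} {M} ω≈ i {p} {q} {ℓ} at-i with begin
  just ℓ                    ≡⟨ channelLabel-self p q ℓ ⟨
  inLabel p q (inp p q ℓ)   ≡⟨ cong (inLabel p q) at-i ⟨
  inLabel p q (lookup ω i)  ≡⟨ mapMaybe≡[]⇒nothing (inLabel p q) ω no-ins i ⟩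
  nothing                   ∎
  where
  open ≡-Reasoning
  no-ins : ins p q ω ≡ []
  no-ins = trans (ins-resp-≈O p q ω≈) (ins-otr p q M)
... | ()

module _ {G : GGraph} {R : Fin (size G) → Queue → Set} (closed : BackClosed G R) where

  step-at : ∀ {x M n} → node G x ≡ n → R x M → StepN G R x n M
  step-at {x} {M} node≡n r = subst (λ n → StepN G R x n M) node≡n (closed x M r)

  BackClosed⇒transition : ∀ {x y M c} → R x M → Edge G x c y → ∃ λ M′ → R y M′ × M ─[ c ]→ M′
  BackClosed⇒transition r (eout {ℓ = ℓ} {y} node≡ ℓ,y∈bs) =
    _ , proj₂ (step-at node≡ r) ℓ y ℓ,y∈bs , send
  BackClosed⇒transition r (einp node≡) with lower (step-at node≡ r)
  ... | M′ , M≈ , r′ = M′ , r′ , receive M≈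

  input-edge⇒NextOutput : ∀ {x y M p q ℓ} ω → R x M → QueueAfter ω M →
    Edge G x (inp p q ℓ) y → NextOutput p q ℓ (ω ++ [])
  input-edge⇒NextOutput ω r after e with BackClosed⇒transition r e
  ... | _ , _ , receive M≈ =
    subst (NextOutput _ _ _) (sym (++-identityʳ ω)) (receive⇒NextOutput ω after M≈)

  Tr⇒NextOutput : ∀ {x M τ} ω → R x M → QueueAfter ω M → Tr G x τ →
    ∀ (k : Fin (length τ)) {p q ℓ} → lookup τ k ≡ inp p q ℓ →
    NextOutput p q ℓ (ω ++ take (toℕ k) τ)
  Tr⇒NextOutput ω r after (last e)    zero    refl = input-edge⇒NextOutput ω r after e
  Tr⇒NextOutput ω r after (step e tr) zero    refl = input-edge⇒NextOutput ω r after e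
  Tr⇒NextOutput ω r after (step {c = c} {τ = τ} e tr) (suc k) at-k with BackClosed⇒transition r e
  ... | _ , r′ , transition =
    subst (NextOutput _ _ _) (++-assoc ω [ c ] (take (toℕ k) τ))
      (Tr⇒NextOutput (ω ++ [ c ]) r′ (QueueAfter-step ω after transition) tr k at-k)

NextOutput⇒Matches : ∀ τ (j : Fin (length τ)) {p q ℓ} → lookup τ j ≡ inp p q ℓ →
  NextOutput p q ℓ (take (toℕ j) τ) → ∃ λ i → Matches τ j i
NextOutput⇒Matches τ j {p} {q} {ℓ} at-j (rest , outs≡)
  with mapMaybe-take-source (outLabel p q) τ j _ ℓ rest outs≡
... | i , i<j , at-i , outs-before-i =
  i , p , q , ℓ , at-j , outLabel-just at-i , i<j ,
  trans (#out≡length-outs p q (take (toℕ i) τ))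
        (trans (cong length outs-before-i) (sym (#inp≡length-ins p q (take (toℕ j) τ))))

lemma7p11 : (G : GGraph) → WFGraph G → (x : Fin (size G)) → (M : Queue) →
    Balanced G x M → (ω : Trace) → ω ≈O otr M → (τ : Trace) → Tr G x τ →
    OmegaWellFormed ω τ
lemma7p11 _ _ _ _ (_ , closed , r) ω ω≈ τ tr j p q ℓ at-j with lookup-++-split ω τ j
... | inj₁ (i , at-i) = ⊥-elim (≈O-otr⇒no-inputs ω≈ i (trans (sym at-i) at-j))
... | inj₂ (k , at-k , take≡) =
  NextOutput⇒Matches (ω ++ τ) j at-j
    (subst (NextOutput p q ℓ) (sym take≡)
      (Tr⇒NextOutput closed ω r (≈O-otr⇒QueueAfter ω≈) tr k (trans (sym at-k) at-j)))
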